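{- Let $\lambda$ be a partition, $A=\mathcal{L}(\lambda)$, and let $i,j\ge1$ be integers with $\lambda[i,j]\neq()$. (1) If $\mathbb{SG}(A[i,j])=0$, then $d(\lambda[i,j])\ge1$ and $\mathbb{SG}(A[i-1,j-1])=0$. (2) If $\mathbb{SG}(A[i,j])=1$ and $d(\lambda[i,j])\ge2$, then $\mathbb{SG}(A[i-1,j-1])=1$. (3) If $\mathbb{SG}(A[i,j])=2$ and $d(\lambda[i,j])\ge3$, then $\mathbb{SG}(A[i-1,j-1])=2$.
   Context: For a partition $\mu=(\mu_1,\dots,\mu_s)$ and nonnegative integers $i,j$, $\mu[i,j]$ is $(\mu_{i+1}-j,\mu_{i+2}-j,\dots)$ with nonpositive entries removed, if $i<s$ and $j<\mu_{i+1}$; otherwise $\mu[i,j]=()$. The Durfee length is $d(\mu)=\max\{k:\mu_k\ge k\}$ ($0$ for the empty partition). LCTR $\mathcal{L}(\lambda)$: impartial normal-play game on partitions; from a nonempty $\mu$ one moves to $\mu[1,0]$ or $\mu[0,1]$; $()$ is terminal. For $A=\mathcal{L}(\lambda)$, $A[i,j]=\mathcal{L}(\lambda[i,j])$. $\mathbb{SG}$ is the Sprague--Grundy value, $\mathbb{SG}(A)=\operatorname{mex}\{\mathbb{SG}(B):A\to B\}$. -}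

module Defs where

open import Data.Nat using (ℕ; zero; suc; _+_; _∸_; _≤_; _<_; _≥_; _≟_; _<?_; _≤?_; _⊔_)
open import Data.List using (List; []; _∷_; drop; map; filter; length)
open import Data.Nat.ListAction using (sum)
open import Data.List.Relation.Unary.All using (All)
open import Data.List.Relation.Unary.Linked using (Linked)
open import Data.List.Membership.DecPropositional _≟_ using (_∈?_)
open import Relation.Nullary using (yes; no; ¬?)

Partition : Set
Partition = List ℕ

IsPartition : Partition → Set
IsPartition μ = All (λ x → 1 ≤ x) μ × Linked _≥_ μ
  where open import Data.Product using (_×_)

_[_,_] : Partition → ℕ → ℕ → Partition
μ [ i , j ] with drop i μ
... | []       = []
... | (a ∷ as) with j <? a
...   | yes _ = filter (λ x → 1 ≤? x) (map (_∸ j) (a ∷ as))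
...   | no  _ = []

-- Durfee length d(μ) = max{k : μ_k ≥ k} (0 if no such k), 1-indexed.
durfeeFrom : ℕ → Partition → ℕ
durfeeFrom k [] = 0
durfeeFrom k (x ∷ xs) with suc k ≤? x
... | yes _ = suc k ⊔ durfeeFrom (suc k) xs
... | no  _ = durfeeFrom (suc k) xs

durfee : Partition → ℕ
durfee μ = durfeeFrom 0 μ

mexFrom : ℕ → ℕ → List ℕ → ℕ
mexFrom n zero xs = n
mexFrom n (suc fuel) xs with n ∈? xs
... | yes _ = mexFrom (suc n) fuel xs
... | no  _ = n

mex : List ℕ → ℕ
mex xs = mexFrom 0 (length xs) xs

-- Each move strictly decreases sum μ + length μ, so fuel suc (sum μ + length μ)
-- suffices for the recursion to reach terminal positions.
sgFuel : ℕ → Partition → ℕ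
sgFuel zero μ = 0
sgFuel (suc f) [] = 0
sgFuel (suc f) (x ∷ xs) =
  mex (sgFuel f ((x ∷ xs) [ 1 , 0 ]) ∷ sgFuel f ((x ∷ xs) [ 0 , 1 ]) ∷ [])

-- LCTR game L(μ) is represented by its position μ; SG(L(μ)):
SG : Partition → ℕ
SG μ = sgFuel (suc (sum μ + length μ)) μ

-- Removing rows and columns composes, λ[i,j][i',j'] = λ[i+i',j+j'], so the positions λ[i,j]
-- form a grid in which every nonempty cell has the two options λ[i+1,j] and λ[i,j+1] and its
-- Sprague–Grundy value is the mex of theirs. The three claims are facts about such grids, each
-- using the previous ones: a 0 at (i+1,j+1) makes both options of (i,j) nonzero; a 1 at
-- (i+1,j+1) has an option 0, which the first claim moves to an option of (i,j), while the
-- other option of (i,j) has that 1 among its own options; a 2 has options 0 and 1, which the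
-- first two claims move to the options of (i,j). The Durfee bounds keep the cells used
-- nonempty, since d(ν) ≥ n+1 forces ν[n,n] ≠ ().
module Submission where

open import Defs
open import Data.Nat using (ℕ; zero; suc; _+_; _∸_; _≤_; _<_; _≥_; _<?_; _≤?_; z≤n; s≤s; z<s)
open import Data.Nat.Properties
open import Data.List using (List; []; _∷_; drop; map; filter; length)
open import Data.Nat.ListAction using (sum)
open import Data.List.Properties using (filter-accept; filter-reject; drop-drop)
open import Data.List.Relation.Unary.All as All using (All; []; _∷_)
open import Data.List.Relation.Unary.All.Properties using (all-filter; drop⁺)
open import Data.List.Relation.Unary.Linked as Linked using (Linked; [])
open import Data.List.Relation.Unary.Linked.Properties using (Linked⇒All; map⁺; filter⁺)
open import Data.Product using (_×_; _,_; ∃₂)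
open import Data.Sum using (_⊎_; inj₁; inj₂)
open import Relation.Nullary using (yes; no; ¬_; contradiction)
open import Relation.Binary.PropositionalEquality hiding ([_])
open import Function using (_∘_; case_of_)
open import Relation.Binary.Properties.Poset ≤-poset using (≥-trans)

mex₂ : ℕ → ℕ → ℕ
mex₂ a b = mex (a ∷ b ∷ [])

mex₂-≢ˡ : ∀ a b → mex₂ a b ≢ a
mex₂-≢ˡ 0             0             = λ ()
mex₂-≢ˡ 0             1             = λ ()
mex₂-≢ˡ 0             (suc (suc b)) = λ ()
mex₂-≢ˡ 1             0             = λ ()
mex₂-≢ˡ 1             (suc b)       = λ ()
mex₂-≢ˡ (suc (suc a)) 0             = λ ()
mex₂-≢ˡ (suc (suc a)) (suc b)       = λ ()

mex₂-≢ʳ : ∀ a b → mex₂ a b ≢ b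
mex₂-≢ʳ 0             0             = λ ()
mex₂-≢ʳ 1             0             = λ ()
mex₂-≢ʳ (suc (suc a)) 0             = λ ()
mex₂-≢ʳ 0             1             = λ ()
mex₂-≢ʳ (suc a)       1             = λ ()
mex₂-≢ʳ 0             (suc (suc b)) = λ ()
mex₂-≢ʳ (suc a)       (suc (suc b)) = λ ()

mex₂≡0 : ∀ a b → a ≢ 0 → b ≢ 0 → mex₂ a b ≡ 0
mex₂≡0 0       _       a≢0 _   = contradiction refl a≢0
mex₂≡0 (suc a) 0       _   b≢0 = contradiction refl b≢0
mex₂≡0 (suc a) (suc b) _   _   = refl

mex₂≡1⇒ : ∀ a b → mex₂ a b ≡ 1 → a ≡ 0 ⊎ b ≡ 0
mex₂≡1⇒ 0       _       _  = inj₁ refl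
mex₂≡1⇒ (suc a) 0       _  = inj₂ refl
mex₂≡1⇒ (suc a) (suc b) ()

mex₂≡2⇒ : ∀ a b → mex₂ a b ≡ 2 → (a ≡ 0 × b ≡ 1) ⊎ (a ≡ 1 × b ≡ 0)
mex₂≡2⇒ 0             1             _  = inj₁ (refl , refl)
mex₂≡2⇒ 1             0             _  = inj₂ (refl , refl)
mex₂≡2⇒ 0             0             ()
mex₂≡2⇒ 0             (suc (suc b)) ()
mex₂≡2⇒ (suc (suc a)) 0             ()
mex₂≡2⇒ (suc a)       (suc b)       ()

mex₂-0ˡ : ∀ b → b ≢ 1 → mex₂ 0 b ≡ 1
mex₂-0ˡ 0             _   = refl
mex₂-0ˡ 1             b≢1 = contradiction refl b≢1
mex₂-0ˡ (suc (suc b)) _   = refl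

mex₂-0ʳ : ∀ a → a ≢ 1 → mex₂ a 0 ≡ 1
mex₂-0ʳ 0             _   = refl
mex₂-0ʳ 1             a≢1 = contradiction refl a≢1
mex₂-0ʳ (suc (suc a)) _   = refl

module MexGrid
  (Live : ℕ → ℕ → Set) (g : ℕ → ℕ → ℕ)
  (g-rec : ∀ {i j} → Live i j → g i j ≡ mex₂ (g (suc i) j) (g i (suc j)))
  (Live-up : ∀ {i j} → Live (suc i) j → Live i j)
  (Live-left : ∀ {i j} → Live i (suc j) → Live i j)
  where

  Live-diag : ∀ {i j} → Live (suc i) (suc j) → Live i j
  Live-diag live = Live-up (Live-left live)

  g≢below : ∀ {i j} → Live i j → g i j ≢ g (suc i) j
  g≢below {i} {j} live eq = mex₂-≢ˡ (g (suc i) j) (g i (suc j)) (trans (sym (g-rec live)) eq)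

  g≢right : ∀ {i j} → Live i j → g i j ≢ g i (suc j)
  g≢right {i} {j} live eq = mex₂-≢ʳ (g (suc i) j) (g i (suc j)) (trans (sym (g-rec live)) eq)

  diagonal-0 : ∀ {i j} → Live (suc i) (suc j) → g (suc i) (suc j) ≡ 0 → g i j ≡ 0
  diagonal-0 {i} {j} live g≡0 = trans (g-rec (Live-diag live))
    (mex₂≡0 (g (suc i) j) (g i (suc j))
      (λ below≡0 → g≢right (Live-left live) (trans below≡0 (sym g≡0)))
      (λ right≡0 → g≢below (Live-up live) (trans right≡0 (sym g≡0))))

  diagonal-1 : ∀ {i j} → Live (suc (suc i)) (suc (suc j)) →
               g (suc i) (suc j) ≡ 1 → g i j ≡ 1
  diagonal-1 {i} {j} live g≡1
    with mex₂≡1⇒ (g (suc (suc i)) (suc j)) (g (suc i) (suc (suc j)))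
                 (trans (sym (g-rec (Live-diag live))) g≡1)
  ... | inj₁ below≡0 = begin
    g i j                            ≡⟨ g-rec (Live-diag (Live-diag live)) ⟩
    mex₂ (g (suc i) j) (g i (suc j)) ≡⟨ cong (λ a → mex₂ a (g i (suc j))) (diagonal-0 (Live-left live) below≡0) ⟩
    mex₂ 0 (g i (suc j))             ≡⟨ mex₂-0ˡ (g i (suc j)) right≢1 ⟩
    1                                ∎
    where
    open ≡-Reasoning
    right≢1 : g i (suc j) ≢ 1
    right≢1 right≡1 = g≢below (Live-diag (Live-up live)) (trans right≡1 (sym g≡1))
  ... | inj₂ right≡0 = begin
    g i j                            ≡⟨ g-rec (Live-diag (Live-diag live)) ⟩
    mex₂ (g (suc i) j) (g i (suc j)) ≡⟨ cong (mex₂ (g (suc i) j)) (diagonal-0 (Live-up live) right≡0) ⟩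
    mex₂ (g (suc i) j) 0             ≡⟨ mex₂-0ʳ (g (suc i) j) below≢1 ⟩
    1                                ∎
    where
    open ≡-Reasoning
    below≢1 : g (suc i) j ≢ 1
    below≢1 below≡1 = g≢right (Live-diag (Live-left live)) (trans below≡1 (sym g≡1))

  diagonal-2 : ∀ {i j} → Live (suc (suc (suc i))) (suc (suc (suc j))) →
               g (suc i) (suc j) ≡ 2 → g i j ≡ 2
  diagonal-2 {i} {j} live g≡2
    with mex₂≡2⇒ (g (suc (suc i)) (suc j)) (g (suc i) (suc (suc j)))
                 (trans (sym (g-rec (Live-diag (Live-diag live)))) g≡2)
  ... | inj₁ (below≡0 , right≡1) = trans (g-rec (Live-diag (Live-diag (Live-diag live))))
    (cong₂ mex₂ (diagonal-0 (Live-diag (Live-left live)) below≡0) (diagonal-1 (Live-up live) right≡1))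
  ... | inj₂ (below≡1 , right≡0) = trans (g-rec (Live-diag (Live-diag (Live-diag live))))
    (cong₂ mex₂ (diagonal-1 (Live-left live) below≡1) (diagonal-0 (Live-diag (Live-up live)) right≡0))

dropCols : ℕ → List ℕ → List ℕ
dropCols j l = filter (λ x → 1 ≤? x) (map (_∸ j) l)

dropCols-keep : ∀ j y ys → 1 ≤ y ∸ j → dropCols j (y ∷ ys) ≡ y ∸ j ∷ dropCols j ys
dropCols-keep _ _ _ = filter-accept (1 ≤?_)

dropCols-skip : ∀ j y ys → ¬ 1 ≤ y ∸ j → dropCols j (y ∷ ys) ≡ dropCols j ys
dropCols-skip _ _ _ = filter-reject (1 ≤?_)

≤⇒¬1≤∸ : ∀ {y j} → y ≤ j → ¬ 1 ≤ y ∸ j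
≤⇒¬1≤∸ y≤j 1≤y∸j = m<n⇒n≢0 1≤y∸j (m≤n⇒m∸n≡0 y≤j)

dropCols-≤ : ∀ {j l} → All (_≤ j) l → dropCols j l ≡ []
dropCols-≤ []                          = refl
dropCols-≤ {j} {y ∷ ys} (y≤j ∷ ys≤j) = trans (dropCols-skip j y ys (≤⇒¬1≤∸ y≤j)) (dropCols-≤ ys≤j)

dropCols-dropCols : ∀ m n l → dropCols m (dropCols n l) ≡ dropCols (n + m) l
dropCols-dropCols m n []       = refl
dropCols-dropCols m n (y ∷ ys) with 1 ≤? y ∸ n
... | no ¬p = begin
  dropCols m (dropCols n (y ∷ ys)) ≡⟨ cong (dropCols m) (dropCols-skip n y ys ¬p) ⟩
  dropCols m (dropCols n ys)       ≡⟨ dropCols-dropCols m n ys ⟩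
  dropCols (n + m) ys              ≡⟨ dropCols-skip (n + m) y ys (λ q → ¬p (≤-trans q (∸-monoʳ-≤ y (m≤m+n n m)))) ⟨
  dropCols (n + m) (y ∷ ys)        ∎
  where open ≡-Reasoning
... | yes p with 1 ≤? y ∸ n ∸ m
...   | yes q = begin
  dropCols m (dropCols n (y ∷ ys))       ≡⟨ cong (dropCols m) (dropCols-keep n y ys p) ⟩
  dropCols m (y ∸ n ∷ dropCols n ys)     ≡⟨ dropCols-keep m (y ∸ n) (dropCols n ys) q ⟩
  y ∸ n ∸ m ∷ dropCols m (dropCols n ys) ≡⟨ cong₂ _∷_ (∸-+-assoc y n m) (dropCols-dropCols m n ys) ⟩
  y ∸ (n + m) ∷ dropCols (n + m) ys      ≡⟨ dropCols-keep (n + m) y ys (subst (1 ≤_) (∸-+-assoc y n m) q) ⟨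
  dropCols (n + m) (y ∷ ys)              ∎
  where open ≡-Reasoning
...   | no ¬q = begin
  dropCols m (dropCols n (y ∷ ys))   ≡⟨ cong (dropCols m) (dropCols-keep n y ys p) ⟩
  dropCols m (y ∸ n ∷ dropCols n ys) ≡⟨ dropCols-skip m (y ∸ n) (dropCols n ys) ¬q ⟩
  dropCols m (dropCols n ys)         ≡⟨ dropCols-dropCols m n ys ⟩
  dropCols (n + m) ys                ≡⟨ dropCols-skip (n + m) y ys (¬q ∘ subst (1 ≤_) (sym (∸-+-assoc y n m))) ⟨
  dropCols (n + m) (y ∷ ys)          ∎
  where open ≡-Reasoning

linked-drop⁺ : ∀ {l} i → Linked _≥_ l → Linked _≥_ (drop i l)
linked-drop⁺ zero    lk = lk
linked-drop⁺ {[]}    (suc i) _  = []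
linked-drop⁺ {_ ∷ _} (suc i) lk = linked-drop⁺ i (Linked.tail lk)

dropCols-linked : ∀ j {l} → Linked _≥_ l → Linked _≥_ (dropCols j l)
dropCols-linked j lk = filter⁺ (1 ≤?_) ≥-trans (map⁺ (Linked.map (∸-monoˡ-≤ j) lk))

drop-dropCols : ∀ i j {l} → Linked _≥_ l → drop i (dropCols j l) ≡ dropCols j (drop i l)
drop-dropCols zero    j          _  = refl
drop-dropCols (suc i) j {[]}     _  = refl
drop-dropCols (suc i) j {y ∷ ys} lk with y ≤? j
... | yes y≤j = begin
  drop (suc i) (dropCols j (y ∷ ys)) ≡⟨ cong (drop (suc i)) (dropCols-≤ y∷ys≤j) ⟩
  []                                 ≡⟨ dropCols-≤ (drop⁺ i (All.tail y∷ys≤j)) ⟨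
  dropCols j (drop i ys)             ∎
  where
  open ≡-Reasoning
  y∷ys≤j : All (_≤ j) (y ∷ ys)
  y∷ys≤j = Linked⇒All ≥-trans y≤j lk
... | no y≰j = begin
  drop (suc i) (dropCols j (y ∷ ys)) ≡⟨ cong (drop (suc i)) (dropCols-keep j y ys (m<n⇒0<n∸m (≰⇒> y≰j))) ⟩
  drop i (dropCols j ys)             ≡⟨ drop-dropCols i j (Linked.tail lk) ⟩
  dropCols j (drop i ys)             ∎
  where open ≡-Reasoning

[,]≡dropCols-drop : ∀ {μ} i j → Linked _≥_ μ → μ [ i , j ] ≡ dropCols j (drop i μ)
[,]≡dropCols-drop {μ} i j lk with drop i μ | linked-drop⁺ i lk
... | []     | _   = refl
... | a ∷ as | lk′ with j <? a
...   | yes _  = refl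
...   | no j≮a = sym (dropCols-≤ (Linked⇒All ≥-trans (≮⇒≥ j≮a) lk′))

[,]-linked : ∀ {μ} i j → Linked _≥_ μ → Linked _≥_ (μ [ i , j ])
[,]-linked i j lk = subst (Linked _≥_) (sym ([,]≡dropCols-drop i j lk)) (dropCols-linked j (linked-drop⁺ i lk))

[,]-[,] : ∀ {μ} i j i′ j′ → Linked _≥_ μ → μ [ i , j ] [ i′ , j′ ] ≡ μ [ i + i′ , j + j′ ]
[,]-[,] {μ} i j i′ j′ lk = begin
  μ [ i , j ] [ i′ , j′ ]                        ≡⟨ [,]≡dropCols-drop i′ j′ ([,]-linked i j lk) ⟩
  dropCols j′ (drop i′ (μ [ i , j ]))           ≡⟨ cong (dropCols j′ ∘ drop i′) ([,]≡dropCols-drop i j lk) ⟩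
  dropCols j′ (drop i′ (dropCols j (drop i μ))) ≡⟨ cong (dropCols j′) (drop-dropCols i′ j (linked-drop⁺ i lk)) ⟩
  dropCols j′ (dropCols j (drop i′ (drop i μ))) ≡⟨ dropCols-dropCols j′ j (drop i′ (drop i μ)) ⟩
  dropCols (j + j′) (drop i′ (drop i μ))        ≡⟨ cong (dropCols (j + j′)) (drop-drop i i′ μ) ⟩
  dropCols (j + j′) (drop (i + i′) μ)           ≡⟨ [,]≡dropCols-drop (i + i′) (j + j′) lk ⟨
  μ [ i + i′ , j + j′ ]                          ∎
  where open ≡-Reasoning

[]-[,] : ∀ i j → [] [ i , j ] ≡ []
[]-[,] zero    j = refl
[]-[,] (suc i) j = refl

weight : List ℕ → ℕ
weight l = sum l + length l

weight-∷ : ∀ x xs → weight (x ∷ xs) ≡ suc (x + weight xs)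
weight-∷ x xs = begin
  (x + sum xs) + suc (length xs) ≡⟨ +-suc (x + sum xs) (length xs) ⟩
  suc ((x + sum xs) + length xs) ≡⟨ cong suc (+-assoc x (sum xs) (length xs)) ⟩
  suc (x + weight xs)            ∎
  where open ≡-Reasoning

weight-tail< : ∀ x xs → weight xs < weight (x ∷ xs)
weight-tail< x xs = subst (weight xs <_) (sym (weight-∷ x xs)) (s≤s (m≤n+m (weight xs) x))

sum<weight : ∀ x xs → sum (x ∷ xs) < weight (x ∷ xs)
sum<weight x xs = m<m+n (sum (x ∷ xs)) z<s

weight-dropCols≤ : ∀ j l → weight (dropCols j l) ≤ weight l
weight-dropCols≤ j []       = z≤n
weight-dropCols≤ j (y ∷ ys) with 1 ≤? y ∸ j
... | no ¬p = begin
  weight (dropCols j (y ∷ ys)) ≡⟨ cong weight (dropCols-skip j y ys ¬p) ⟩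
  weight (dropCols j ys)       ≤⟨ weight-dropCols≤ j ys ⟩
  weight ys                    <⟨ weight-tail< y ys ⟩
  weight (y ∷ ys)              ∎
  where open ≤-Reasoning
... | yes p = begin
  weight (dropCols j (y ∷ ys))         ≡⟨ cong weight (dropCols-keep j y ys p) ⟩
  weight (y ∸ j ∷ dropCols j ys)       ≡⟨ weight-∷ (y ∸ j) (dropCols j ys) ⟩
  suc (y ∸ j + weight (dropCols j ys)) ≤⟨ s≤s (+-mono-≤ (m∸n≤m y j) (weight-dropCols≤ j ys)) ⟩
  suc (y + weight ys)                  ≡⟨ weight-∷ y ys ⟨
  weight (y ∷ ys)                      ∎
  where open ≤-Reasoning

weight-dropCols₁≤sum : ∀ l → weight (dropCols 1 l) ≤ sum l
weight-dropCols₁≤sum []                  = z≤n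
weight-dropCols₁≤sum (0 ∷ ys)            = weight-dropCols₁≤sum ys
weight-dropCols₁≤sum (1 ∷ ys)            = m≤n⇒m≤1+n (weight-dropCols₁≤sum ys)
weight-dropCols₁≤sum (suc (suc y) ∷ ys) =
  subst (_≤ suc (suc y + sum ys)) (sym (weight-∷ (suc y) (dropCols 1 ys)))
        (s≤s (+-monoʳ-≤ (suc y) (weight-dropCols₁≤sum ys)))

weight-[,]≤ : ∀ μ i j → weight (μ [ i , j ]) ≤ weight (dropCols j (drop i μ))
weight-[,]≤ μ i j with drop i μ
... | []     = z≤n
... | a ∷ as with j <? a
...   | yes _ = ≤-refl
...   | no  _ = z≤n

weight-[1,0]< : ∀ x xs → weight ((x ∷ xs) [ 1 , 0 ]) < weight (x ∷ xs)
weight-[1,0]< x xs = begin-strict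
  weight ((x ∷ xs) [ 1 , 0 ]) ≤⟨ weight-[,]≤ (x ∷ xs) 1 0 ⟩
  weight (dropCols 0 xs)      ≤⟨ weight-dropCols≤ 0 xs ⟩
  weight xs                   <⟨ weight-tail< x xs ⟩
  weight (x ∷ xs)             ∎
  where open ≤-Reasoning

weight-[0,1]< : ∀ x xs → weight ((x ∷ xs) [ 0 , 1 ]) < weight (x ∷ xs)
weight-[0,1]< x xs = begin-strict
  weight ((x ∷ xs) [ 0 , 1 ]) ≤⟨ weight-[,]≤ (x ∷ xs) 0 1 ⟩
  weight (dropCols 1 (x ∷ xs)) ≤⟨ weight-dropCols₁≤sum (x ∷ xs) ⟩
  sum (x ∷ xs)                <⟨ sum<weight x xs ⟩
  weight (x ∷ xs)             ∎
  where open ≤-Reasoning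

sgFuel-stable : ∀ {f f′} μ → weight μ < f → weight μ < f′ → sgFuel f μ ≡ sgFuel f′ μ
sgFuel-stable {suc f} {suc f′} []       _          _           = refl
sgFuel-stable {suc f} {suc f′} (x ∷ xs) (s≤s w≤f) (s≤s w≤f′) =
  cong₂ mex₂ (stable (weight-[1,0]< x xs)) (stable (weight-[0,1]< x xs))
  where
  stable : ∀ {ν} → weight ν < weight (x ∷ xs) → sgFuel f ν ≡ sgFuel f′ ν
  stable {ν} w< = sgFuel-stable ν (<-≤-trans w< w≤f) (<-≤-trans w< w≤f′)

SG-rec : ∀ μ → μ ≢ [] → SG μ ≡ mex₂ (SG (μ [ 1 , 0 ])) (SG (μ [ 0 , 1 ]))
SG-rec []       μ≢[] = contradiction refl μ≢[]
SG-rec (x ∷ xs) _    = cong₂ mex₂ (sgFuel-stable _ (weight-[1,0]< x xs) ≤-refl)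
                                  (sgFuel-stable _ (weight-[0,1]< x xs) ≤-refl)

durfeeFrom-≤ : ∀ {k l} → All (_≤ k) l → durfeeFrom k l ≡ 0
durfeeFrom-≤             []             = refl
durfeeFrom-≤ {k} {y ∷ _} (y≤k ∷ ys≤k) with suc k ≤? y
... | yes k<y = contradiction (≤-trans k<y y≤k) (n≮n k)
... | no  _   = durfeeFrom-≤ (All.map m≤n⇒m≤1+n ys≤k)

durfeeFrom-head : ∀ {k y ys} → Linked _≥_ (y ∷ ys) → suc k ≤ durfeeFrom k (y ∷ ys) → suc k ≤ y
durfeeFrom-head {k} {y} {ys} lk k<d with suc k ≤? y
... | yes k<y = k<y
... | no  k≮y = contradiction (subst (suc k ≤_) rest≡0 k<d) λ ()
  where
  rest≡0 : durfeeFrom (suc k) ys ≡ 0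
  rest≡0 = durfeeFrom-≤ (All.tail (Linked⇒All ≥-trans (<⇒≤ (≰⇒> k≮y)) lk))

durfeeFrom-tail : ∀ {k y ys m} → suc (suc k) ≤ m → m ≤ durfeeFrom k (y ∷ ys) → m ≤ durfeeFrom (suc k) ys
durfeeFrom-tail {k} {y} k<m m≤d with suc k ≤? y
... | no  _ = m≤d
... | yes _ = ≮⇒≥ (λ rest<m → <⇒≱ (⊔-pres-<m k<m rest<m) m≤d)

durfeeFrom-drop : ∀ k m {l} → Linked _≥_ l → suc (m + k) ≤ durfeeFrom k l →
                  ∃₂ λ a as → drop m l ≡ a ∷ as × suc (m + k) ≤ a
durfeeFrom-drop k zero    {y ∷ ys} lk k<d = y , ys , refl , durfeeFrom-head lk k<d
durfeeFrom-drop k (suc m) {y ∷ ys} lk m<d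
  with durfeeFrom-drop (suc k) m (Linked.tail lk)
         (subst (λ n → suc n ≤ durfeeFrom (suc k) ys) (sym (+-suc m k))
                (durfeeFrom-tail {y = y} (s≤s (s≤s (m≤n+m k m))) m<d))
... | a , as , eq , m<a = a , as , eq , subst (λ n → suc n ≤ a) (+-suc m k) m<a

durfee⇒[n,n]≢[] : ∀ {μ} n → Linked _≥_ μ → suc n ≤ durfee μ → μ [ n , n ] ≢ []
durfee⇒[n,n]≢[] {μ} n lk n<d
  with durfeeFrom-drop 0 n lk (subst (λ k → suc k ≤ durfee μ) (sym (+-identityʳ n)) n<d)
... | a , as , eq , n<a = λ μ[n,n]≡[] → case trans (sym μ[n,n]≡row) μ[n,n]≡[] of λ ()
  where
  μ[n,n]≡row : μ [ n , n ] ≡ a ∸ n ∷ dropCols n as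
  μ[n,n]≡row = begin
    μ [ n , n ]             ≡⟨ [,]≡dropCols-drop n n lk ⟩
    dropCols n (drop n μ)   ≡⟨ cong (dropCols n) eq ⟩
    dropCols n (a ∷ as)     ≡⟨ dropCols-keep n a as (m<n⇒0<n∸m (subst (_< a) (+-identityʳ n) n<a)) ⟩
    a ∸ n ∷ dropCols n as   ∎
    where open ≡-Reasoning

[,]-positive : ∀ μ i j → All (1 ≤_) (μ [ i , j ])
[,]-positive μ i j with drop i μ
... | []     = []
... | a ∷ as with j <? a
...   | yes _ = all-filter (1 ≤?_) (map (_∸ j) (a ∷ as))
...   | no  _ = []

durfee-pos : ∀ {μ} → All (1 ≤_) μ → μ ≢ [] → 1 ≤ durfee μ
durfee-pos {[]}    _          μ≢[] = contradiction refl μ≢[]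
durfee-pos {x ∷ xs} (1≤x ∷ _) _   with 1 ≤? x
... | yes _   = m≤m⊔n 1 (durfeeFrom 1 xs)
... | no  1≰x = contradiction 1≤x 1≰x

module PartitionGrid {μ : Partition} (lk : Linked _≥_ μ) where

  Live : ℕ → ℕ → Set
  Live i j = μ [ i , j ] ≢ []

  shift : ∀ i j i′ j′ → μ [ i , j ] [ i′ , j′ ] ≡ μ [ i′ + i , j′ + j ]
  shift i j i′ j′ = trans ([,]-[,] i j i′ j′ lk) (cong₂ (λ a b → μ [ a , b ]) (+-comm i i′) (+-comm j j′))

  SG-grid-rec : ∀ {i j} → Live i j → SG (μ [ i , j ]) ≡ mex₂ (SG (μ [ suc i , j ])) (SG (μ [ i , suc j ]))
  SG-grid-rec {i} {j} live =
    trans (SG-rec _ live) (cong₂ mex₂ (cong SG (shift i j 1 0)) (cong SG (shift i j 0 1)))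

  Live-shift : ∀ {i j} i′ j′ → Live (i′ + i) (j′ + j) → Live i j
  Live-shift {i} {j} i′ j′ live μ[i,j]≡[] =
    live (trans (sym (shift i j i′ j′)) (trans (cong (λ ν → ν [ i′ , j′ ]) μ[i,j]≡[]) ([]-[,] i′ j′)))

  Live-diagonal : ∀ {i j} n → suc n ≤ durfee (μ [ i , j ]) → Live (n + i) (n + j)
  Live-diagonal {i} {j} n n<d μ[n+i,n+j]≡[] =
    durfee⇒[n,n]≢[] n ([,]-linked i j lk) n<d (trans (shift i j n n) μ[n+i,n+j]≡[])

  open MexGrid Live (λ i j → SG (μ [ i , j ])) (λ {i} {j} → SG-grid-rec {i} {j})
    (λ {i} {j} → Live-shift {i} {j} 1 0) (λ {i} {j} → Live-shift {i} {j} 0 1) public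

lemma5p4 : (λ' : Partition) → IsPartition λ' → (i j : ℕ) → 1 ≤ i → 1 ≤ j →
    λ' [ i , j ] ≢ [] →
    ((SG (λ' [ i , j ]) ≡ 0 → 1 ≤ durfee (λ' [ i , j ]) × SG (λ' [ i ∸ 1 , j ∸ 1 ]) ≡ 0)
    × (SG (λ' [ i , j ]) ≡ 1 → 2 ≤ durfee (λ' [ i , j ]) → SG (λ' [ i ∸ 1 , j ∸ 1 ]) ≡ 1)
    × (SG (λ' [ i , j ]) ≡ 2 → 3 ≤ durfee (λ' [ i , j ]) → SG (λ' [ i ∸ 1 , j ∸ 1 ]) ≡ 2))
lemma5p4 λ' (_ , lk) (suc i) (suc j) _ _ live =
    (λ sg≡0 → durfee-pos ([,]-positive λ' (suc i) (suc j)) live , diagonal-0 live sg≡0)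
  , (λ sg≡1 d≥2 → diagonal-1 (Live-diagonal 1 d≥2) sg≡1)
  , (λ sg≡2 d≥3 → diagonal-2 (Live-diagonal 2 d≥3) sg≡2)
  where open PartitionGrid lk
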